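{- Fix an instance of Fully Online Matching. For any rank vector $\mathbf{y}\in[0,1)^V$ and any vertex $u$: (1) if $u$ is active or unmatched in $M(\mathbf{y})$, then $M(\mathbf{y})$ remains the same when $y_u$ is increased (other ranks fixed); (2) if $u$ is passive in $M(\mathbf{y})$, then $u$ remains passive when $y_u$ is decreased (other ranks fixed).
   Context: Fully Online Matching: a graph $G=(V,E)$; events are arrivals and deadlines of vertices, each vertex's deadline occurring after the arrivals of itself and all its neighbours; at the deadline of an unmatched vertex the algorithm irrevocably matches it to an unmatched neighbour or leaves it unmatched. $M(\mathbf{y})$ denotes the matching produced by Ranking when the ranks are $\mathbf{y}=(y_w)_{w\in V}$: at the deadline of each vertex $w$, if $w$ is unmatched and has unmatched neighbours, $w$ is matched to the unmatched neighbour of smallest rank. When an edge $(u,v)$ is added at $u$'s deadline, $u$ is called active and $v$ passive.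
   Formalization: The ranks take values in the rationals in $[0,1)$ rather than the reals, and ties between equal ranks are broken by vertex index. -}

module Defs where

open import Data.Nat as ℕ using (ℕ; zero; suc; _⊔_)
open import Data.Fin using (Fin; toℕ)
open import Data.Fin.Properties using () renaming (_≟_ to _≟ᶠ_)
open import Data.Bool using (Bool; true; false; _∧_; _∨_; if_then_else_)
open import Data.List using (List; []; _∷_; foldr)
open import Data.Fin.Base using () 
open import Data.List using () renaming (allFin to allFinL)
open import Data.Maybe using (Maybe; just; nothing)
open import Data.Product using (∃; _×_)
open import Data.Rational using (ℚ; 0ℚ; 1ℚ; _≤_; _<_)
open import Data.Rational.Properties using () renaming (_≟_ to _≟ℚ_; _<?_ to _<?ℚ_)
open import Relation.Nullary using (does; ¬_)
open import Relation.Binary.PropositionalEquality using (_≡_)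

record Instance (n : ℕ) : Set where
  field
    adj      : Fin n → Fin n → Bool
    adj-sym  : ∀ u v → adj u v ≡ adj v u
    adj-irr  : ∀ v → adj v v ≡ false
    arr      : Fin n → ℕ
    dl       : Fin n → ℕ
    arr-inj  : ∀ u v → arr u ≡ arr v → u ≡ v
    dl-inj   : ∀ u v → dl u ≡ dl v → u ≡ v
    arr≢dl   : ∀ u v → ¬ (arr u ≡ dl v)
    arr<dl   : ∀ v → arr v ℕ.< dl v
    nbr<dl   : ∀ u v → adj u v ≡ true → arr u ℕ.< dl v

-- Status of a vertex in the (partial) matching built by the algorithm.
-- active v  : matched to v by an edge added at this vertex's own deadline
-- passive v : matched to v by an edge added at v's deadline
data Status (n : ℕ) : Set where
  unmatched : Status n
  active    : Fin n → Status n
  passive   : Fin n → Status n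

State : ℕ → Set
State n = Fin n → Status n

isUnmatched : ∀ {n} → Status n → Bool
isUnmatched unmatched = true
isUnmatched _ = false

Ranks : ℕ → Set
Ranks n = Fin n → ℚ

InUnit : ∀ {n} → Ranks n → Set
InUnit y = ∀ w → 0ℚ ≤ y w × y w < 1ℚ

before : ∀ {n} → Ranks n → Fin n → Fin n → Bool
before y v c = does (y v <?ℚ y c) ∨ (does (y v ≟ℚ y c) ∧ does (toℕ v ℕ.<? toℕ c))

module _ {n : ℕ} (I : Instance n) (y : Ranks n) where
  open Instance I

  bestNbr : State n → Fin n → Maybe (Fin n)
  bestNbr st w = foldr pick nothing (allFinL n)
    where
    eligible : Fin n → Bool
    eligible v = adj w v ∧ isUnmatched (st v)
    pick : Fin n → Maybe (Fin n) → Maybe (Fin n)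
    pick v nothing  = if eligible v then just v else nothing
    pick v (just c) = if eligible v ∧ before y v c then just v else just c

  update : State n → Fin n → Status n → State n
  update st w s x = if does (x ≟ᶠ w) then s else st x

  atDeadline : State n → Fin n → State n
  atDeadline st w with st w | bestNbr st w
  ... | unmatched | just v  = update (update st w (active v)) v (passive w)
  ... | _         | _       = st

  deadlineAt : ℕ → Maybe (Fin n)
  deadlineAt t = foldr (λ w r → if does (dl w ℕ.≟ t) then just w else r) nothing (allFinL n)

  step : ℕ → State n → State n
  step t st with deadlineAt t
  ... | just w  = atDeadline st w
  ... | nothing = st

  -- state after processing all events at times < t
  run : ℕ → State n
  run zero    = λ _ → unmatched
  run (suc t) = step t (run t)

  lastDeadline : ℕ
  lastDeadline = foldr (λ w m → dl w ⊔ m) 0 (allFinL n)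

  final : State n
  final = run (suc lastDeadline)

  mate : Fin n → Maybe (Fin n)
  mate w with final w
  ... | unmatched = nothing
  ... | active v  = just v
  ... | passive v = just v

  IsActive IsPassive IsUnmatched : Fin n → Set
  IsActive u    = ∃ λ v → final u ≡ active v
  IsPassive u   = ∃ λ v → final u ≡ passive v
  IsUnmatched u = final u ≡ unmatched

-- Run Ranking with ranks A and with ranks B that agree off u and have A u < B u, deadline by
-- deadline.  While the two states coincide, the eligible neighbours at a deadline coincide, and
-- raising u changes the tie-broken rank order only by moving u later; so both runs pick the same
-- neighbour unless the A-run picks u, which makes u passive there for good.  Hence either the final
-- states coincide or u ends passive under A.  Part (1) takes A = y, part (2) takes A = y'.
module Submission where

open import Defs
open import Data.Bool using (Bool; true; false; T; _∧_; if_then_else_)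
open import Data.Bool.Properties using (T-∧)
open import Data.Empty using (⊥-elim)
open import Level using (0ℓ)
open import Data.Fin using (Fin; toℕ)
open import Data.Fin.Properties using (toℕ-injective) renaming (_≟_ to _≟ᶠ_)
open import Data.List using (List; []; _∷_; foldr) renaming (allFin to allFinL)
open import Data.List.Properties using (foldr-cong)
open import Data.List.Membership.Propositional using (_∈_)
open import Data.List.Membership.Propositional.Properties using (∈-allFin)
open import Data.List.Relation.Unary.Any using (here; there)
open import Data.Maybe using (Maybe; just; nothing)
open import Data.Nat as ℕ using (ℕ; zero; suc)
import Data.Nat.Properties as ℕₚ
open import Data.Product using (∃; _×_; _,_; proj₂)
open import Data.Product.Relation.Binary.Lex.Strict using (×-Lex; ×-strictTotalOrder; ×-decidable)
open import Data.Rational using (ℚ; _<_)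
import Data.Rational.Properties as ℚ
open import Data.Sum using (_⊎_; inj₁; inj₂; [_,_]; map₂)
open import Function using (_∘_; Equivalence)
open import Relation.Binary using (Rel; Transitive; Asymmetric; Trichotomous; Decidable; tri<; tri≈; tri>; StrictTotalOrder)
open import Relation.Binary.PropositionalEquality using (_≡_; _≢_; refl; sym; trans; cong; subst; subst₂; _≗_; module ≡-Reasoning)
open import Relation.Nullary using (yes; no; does; ¬_)
open import Relation.Nullary.Decidable using (dec-true; dec-false)
open import Relation.Unary using (Pred; Empty; _≐_)

Least : {A : Set} → Rel A 0ℓ → Pred A 0ℓ → Maybe A → Set
Least _≺_ P nothing  = Empty P
Least _≺_ P (just c) = P c × (∀ v → P v → c ≡ v ⊎ c ≺ v)

Least-resp-≐ : ∀ {A : Set} {_≺_ : Rel A 0ℓ} {P Q r} → P ≐ Q → Least _≺_ P r → Least _≺_ Q r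
Least-resp-≐ {r = nothing} (_ , Q⊆P) none v = none v ∘ Q⊆P
Least-resp-≐ {r = just c} (P⊆Q , Q⊆P) (Pc , least) = P⊆Q Pc , λ v → least v ∘ Q⊆P

EligibleIn : {A : Set} → (A → Bool) → List A → Pred A 0ℓ
EligibleIn e xs v = v ∈ xs × T (e v)

module _ {A : Set} {_≺_ : Rel A 0ℓ}
         (≺-trans : Transitive _≺_) (≺-compare : Trichotomous _≡_ _≺_) (_≺?_ : Decidable _≺_) where

  pickLeast : (A → Bool) → A → Maybe A → Maybe A
  pickLeast e v nothing  = if e v then just v else nothing
  pickLeast e v (just c) = if e v ∧ does (v ≺? c) then just v else just c

  pickLeast-least : ∀ {e x xs} r → Least _≺_ (EligibleIn e xs) r →
                    Least _≺_ (EligibleIn e (x ∷ xs)) (pickLeast e x r)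
  pickLeast-least {e} {x} nothing none with e x in ex
  ... | true  = (here refl , subst T (sym ex) _) , λ
      { v (here refl , _) → inj₁ refl
      ; v (there v∈ , ev) → ⊥-elim (none v (v∈ , ev)) }
  ... | false = λ
      { v (here refl , ev) → subst T ex ev
      ; v (there v∈ , ev) → none v (v∈ , ev) }
  pickLeast-least {e} {x} (just c) ((c∈ , ec) , least) with e x in ex | x ≺? c
  ... | true  | yes x≺c = (here refl , subst T (sym ex) _) , λ
      { v (here refl , _) → inj₁ refl
      ; v (there v∈ , ev) → inj₂ ([ (λ { refl → x≺c }) , ≺-trans x≺c ] (least v (v∈ , ev))) }
  ... | true  | no x⊀c = (there c∈ , ec) , λ
      { v (here refl , _) → c≼x
      ; v (there v∈ , ev) → least v (v∈ , ev) }
    where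
    c≼x : c ≡ x ⊎ c ≺ x
    c≼x with ≺-compare x c
    ... | tri< x≺c _ _ = ⊥-elim (x⊀c x≺c)
    ... | tri≈ _ refl _ = inj₁ refl
    ... | tri> _ _ c≺x = inj₂ c≺x
  ... | false | _ = (there c∈ , ec) , λ
      { v (here refl , ev) → ⊥-elim (subst T ex ev)
      ; v (there v∈ , ev) → least v (v∈ , ev) }

  foldr-pickLeast-least : ∀ e xs → Least _≺_ (EligibleIn e xs) (foldr (pickLeast e) nothing xs)
  foldr-pickLeast-least e []       = λ v ()
  foldr-pickLeast-least e (x ∷ xs) = pickLeast-least _ (foldr-pickLeast-least e xs)

_<ₗₑₓ_ : Rel (ℚ × ℕ) 0ℓ
_<ₗₑₓ_ = ×-Lex _≡_ _<_ ℕ._<_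

private
  module Lex = StrictTotalOrder (×-strictTotalOrder ℚ.<-strictTotalOrder ℕₚ.<-strictTotalOrder)

module _ {n : ℕ} where

  rankKey : Ranks n → Fin n → ℚ × ℕ
  rankKey z v = z v , toℕ v

  _≺[_]_ : Fin n → Ranks n → Fin n → Set
  infix 4 _≺[_]_
  a ≺[ z ] b = rankKey z a <ₗₑₓ rankKey z b

  -- Chosen so that `does (≺?[ z ] a b)` is definitionally `before z a b`.
  ≺?[_] : ∀ z → Decidable _≺[ z ]_
  ≺?[ z ] a b = ×-decidable ℚ._≟_ ℚ._<?_ ℕₚ._<?_ (rankKey z a) (rankKey z b)

  ≺-compare : ∀ z → Trichotomous _≡_ _≺[ z ]_
  ≺-compare z a b with Lex.compare (rankKey z a) (rankKey z b)
  ... | tri< lt ne gt = tri< lt (ne ∘ λ { refl → refl , refl }) gt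
  ... | tri≈ nlt (_ , eq) ngt = tri≈ nlt (toℕ-injective eq) ngt
  ... | tri> nlt ne gt = tri> nlt (ne ∘ λ { refl → refl , refl }) gt

  ≺-trans : ∀ z → Transitive _≺[ z ]_
  ≺-trans z = Lex.trans

  ≺-asym : ∀ z → Asymmetric _≺[ z ]_
  ≺-asym z = Lex.asym

  module _ {u : Fin n} {A B : Ranks n} (agree : ∀ w → w ≢ u → B w ≡ A w) (raised : A u < B u) where

    rankKey-agree : ∀ {v} → v ≢ u → rankKey B v ≡ rankKey A v
    rankKey-agree {v} v≢u = cong (_, toℕ v) (agree v v≢u)

    ≺-raise : ∀ {a b} → b ≢ u → a ≺[ B ] b → a ≺[ A ] b
    ≺-raise {a} {b} b≢u a≺b with a ≟ᶠ u
    ... | yes refl = Lex.trans (inj₁ raised) (subst (rankKey B a <ₗₑₓ_) (rankKey-agree b≢u) a≺b)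
    ... | no a≢u   = subst₂ _<ₗₑₓ_ (rankKey-agree a≢u) (rankKey-agree b≢u) a≺b

    -- Raising u only demotes u, so the least element can change only if it was u.
    least-raise : ∀ {P r r'} → Least _≺[ A ]_ P r → Least _≺[ B ]_ P r' → r' ≡ r ⊎ r ≡ just u
    least-raise {r = nothing} {nothing} _ _ = inj₁ refl
    least-raise {r = nothing} {just c'} none (Pc' , _) = ⊥-elim (none c' Pc')
    least-raise {r = just c} {nothing} (Pc , _) none = ⊥-elim (none c Pc)
    least-raise {r = just c} {just c'} (Pc , leastA) (Pc' , leastB) with c ≟ᶠ u
    ... | yes refl = inj₂ refl
    ... | no c≢u with leastA c' Pc' | leastB c Pc
    ...   | inj₁ c≡c' | _         = inj₁ (cong just (sym c≡c'))
    ...   | inj₂ _    | inj₁ c'≡c = inj₁ (cong just c'≡c)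
    ...   | inj₂ c≺c' | inj₂ c'≺c = ⊥-elim (≺-asym A c≺c' (≺-raise c≢u c'≺c))

module _ {n : ℕ} (I : Instance n) where
  open Instance I

  eligible : State n → Fin n → Fin n → Bool
  eligible st w v = adj w v ∧ isUnmatched (st v)

  eligible-unmatched : ∀ st {w v} → T (eligible st w v) → T (isUnmatched (st v))
  eligible-unmatched _ = proj₂ ∘ Equivalence.to T-∧

  eligible-cong : ∀ {st st'} → st ≗ st' → ∀ w → T ∘ eligible st w ≐ T ∘ eligible st' w
  eligible-cong {st} {st'} eq w = (λ {v} → subst T (e v)) , (λ {v} → subst T (sym (e v)))
    where
    e : ∀ v → eligible st w v ≡ eligible st' w v
    e v = cong (λ s → adj w v ∧ isUnmatched s) (eq v)

  bestNbr-least : ∀ z st w → Least _≺[ z ]_ (T ∘ eligible st w) (bestNbr I z st w)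
  bestNbr-least z st w =
    Least-resp-≐ (proj₂ , λ {v} ev → ∈-allFin v , ev)
      (subst (Least _ _) (sym bestNbr≡fold) (foldr-pickLeast-least (≺-trans z) (≺-compare z) ≺?[ z ] _ _))
    where
    bestNbr≡fold : bestNbr I z st w ≡ foldr (pickLeast (≺-trans z) (≺-compare z) ≺?[ z ] (eligible st w)) nothing (allFinL n)
    bestNbr≡fold = foldr-cong (λ { v nothing → refl ; v (just c) → refl }) refl (allFinL n)

  update-same : ∀ z st w s → update I z st w s w ≡ s
  update-same z st w s rewrite dec-true (w ≟ᶠ w) refl = refl

  update-other : ∀ z st w s {x} → x ≢ w → update I z st w s x ≡ st x
  update-other z st w s {x} x≢w rewrite dec-false (x ≟ᶠ w) x≢w = refl

  update-cong : ∀ z z' {st st' : State n} → st ≗ st' → ∀ w s → update I z st w s ≗ update I z' st' w s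
  update-cong _ _ eq w s x = cong (if does (x ≟ᶠ w) then s else_) (eq x)

  applyDeadline : Ranks n → State n → Fin n → Status n → Maybe (Fin n) → State n
  applyDeadline z st w unmatched (just v) = update I z (update I z st w (active v)) v (passive w)
  applyDeadline z st w _         _        = st

  atDeadline≡applyDeadline : ∀ z st w → atDeadline I z st w ≡ applyDeadline z st w (st w) (bestNbr I z st w)
  atDeadline≡applyDeadline z st w with st w | bestNbr I z st w
  ... | unmatched | just _  = refl
  ... | unmatched | nothing = refl
  ... | active _  | _       = refl
  ... | passive _ | _       = refl

  applyDeadline-cong : ∀ z z' {st st'} → st ≗ st' → ∀ w s r → applyDeadline z st w s r ≗ applyDeadline z' st' w s r
  applyDeadline-cong z z' eq w unmatched (just v) =
    update-cong z z' (update-cong z z' eq w (active v)) v (passive w)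
  applyDeadline-cong _ _ eq w unmatched nothing  = eq
  applyDeadline-cong _ _ eq w (active _)  _      = eq
  applyDeadline-cong _ _ eq w (passive _) _      = eq

  atDeadline-keeps-matched : ∀ z st w x → ¬ T (isUnmatched (st x)) → atDeadline I z st w x ≡ st x
  atDeadline-keeps-matched z st w x x-matched
    rewrite atDeadline≡applyDeadline z st w
    with st w in w-unmatched | bestNbr I z st w | bestNbr-least z st w
  ... | unmatched | just v  | (v-eligible , _) =
        trans (update-other z (update I z st w (active v)) v (passive w) x≢v) (update-other z st w (active v) x≢w)
    where
    x≢v : x ≢ v
    x≢v refl = x-matched (eligible-unmatched st v-eligible)
    x≢w : x ≢ w
    x≢w refl = x-matched (subst (T ∘ isUnmatched) (sym w-unmatched) _)
  ... | unmatched | nothing | _ = refl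
  ... | active _  | _       | _ = refl
  ... | passive _ | _       | _ = refl

  step-keeps-matched : ∀ z t st x → ¬ T (isUnmatched (st x)) → step I z t st x ≡ st x
  step-keeps-matched z t st x x-matched with deadlineAt I z t
  ... | just w  = atDeadline-keeps-matched z st w x x-matched
  ... | nothing = refl

  PassiveIn : State n → Fin n → Set
  PassiveIn st u = ∃ λ v → st u ≡ passive v

  passive-is-matched : ∀ {s : Status n} {v} → s ≡ passive v → ¬ T (isUnmatched s)
  passive-is-matched refl = λ ()

  module _ {u : Fin n} {A B : Ranks n} (agree : ∀ w → w ≢ u → B w ≡ A w) (raised : A u < B u) where

    bestNbr-raise : ∀ {stA stB} → stB ≗ stA → ∀ w →
                    bestNbr I B stB w ≡ bestNbr I A stA w ⊎ bestNbr I A stA w ≡ just u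
    bestNbr-raise {stA} {stB} eq w =
      least-raise agree raised (bestNbr-least A stA w) (Least-resp-≐ (eligible-cong eq w) (bestNbr-least B stB w))

    atDeadline-raise : ∀ {stA stB} → stB ≗ stA → ∀ w →
                       atDeadline I B stB w ≗ atDeadline I A stA w ⊎ atDeadline I A stA w u ≡ passive w
    atDeadline-raise {stA} {stB} eq w
      rewrite atDeadline≡applyDeadline B stB w | atDeadline≡applyDeadline A stA w | eq w
      with bestNbr-raise eq w
    ... | inj₁ same rewrite same = inj₁ (applyDeadline-cong B A eq w (stA w) (bestNbr I A stA w))
    ... | inj₂ picks-u rewrite picks-u with stA w
    ...   | unmatched = inj₂ (update-same A (update I A stA w (active u)) u (passive w))
    ...   | active _  = inj₁ eq
    ...   | passive _ = inj₁ eq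

    step-raise : ∀ {stA stB} → stB ≗ stA → ∀ t →
                 step I B t stB ≗ step I A t stA ⊎ PassiveIn (step I A t stA) u
    step-raise eq t with deadlineAt I A t
    ... | just w  = map₂ (w ,_) (atDeadline-raise eq w)
    ... | nothing = inj₁ eq

    run-raise : ∀ t → run I B t ≗ run I A t ⊎ PassiveIn (run I A t) u
    run-raise zero = inj₁ λ _ → refl
    run-raise (suc t) with run-raise t
    ... | inj₁ eq = step-raise eq t
    ... | inj₂ (v , u-passive) =
          inj₂ (v , trans (step-keeps-matched A t (run I A t) u (passive-is-matched u-passive)) u-passive)

    final-raise : final I B ≗ final I A ⊎ IsPassive I A u
    final-raise = run-raise (suc (lastDeadline I A))

  partner : Status n → Maybe (Fin n)
  partner unmatched   = nothing
  partner (active v)  = just v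
  partner (passive v) = just v

  mate≡partner : ∀ z w → mate I z w ≡ partner (final I z w)
  mate≡partner z w with final I z w
  ... | unmatched = refl
  ... | active _  = refl
  ... | passive _ = refl

  mate-cong : ∀ {z z'} → final I z ≗ final I z' → ∀ w → mate I z w ≡ mate I z' w
  mate-cong {z} {z'} eq w = begin
    mate I z w              ≡⟨ mate≡partner z w ⟩
    partner (final I z w)   ≡⟨ cong partner (eq w) ⟩
    partner (final I z' w)  ≡⟨ mate≡partner z' w ⟨
    mate I z' w             ∎
    where open ≡-Reasoning

  passive-not-active-or-unmatched : ∀ {y u} → IsPassive I y u → ¬ (IsActive I y u ⊎ IsUnmatched I y u)
  passive-not-active-or-unmatched (_ , is-passive) (inj₁ (_ , is-active)) with trans (sym is-passive) is-active
  ... | ()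
  passive-not-active-or-unmatched (_ , is-passive) (inj₂ is-unmatched) with trans (sym is-passive) is-unmatched
  ... | ()

  raise-preserves-matching : ∀ {y y' u} → IsActive I y u ⊎ IsUnmatched I y u →
                             (∀ w → w ≢ u → y' w ≡ y w) → y u < y' u → ∀ w → mate I y' w ≡ mate I y w
  raise-preserves-matching not-passive agree raised w with final-raise agree raised
  ... | inj₁ same       = mate-cong same w
  ... | inj₂ u-passive = ⊥-elim (passive-not-active-or-unmatched u-passive not-passive)

  lower-preserves-passive : ∀ {y y' u} → IsPassive I y u →
                            (∀ w → w ≢ u → y' w ≡ y w) → y' u < y u → IsPassive I y' u
  lower-preserves-passive (v , u-passive) agree lowered with final-raise (λ w w≢u → sym (agree w w≢u)) lowered
  ... | inj₁ same        = v , trans (sym (same _)) u-passive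
  ... | inj₂ u-passive' = u-passive'

lemma1 : ∀ {n} (I : Instance n) (y : Ranks n) → InUnit y → (u : Fin n) →
    ((IsActive I y u ⊎ IsUnmatched I y u) →
    ∀ (y' : Ranks n) → InUnit y' → (∀ w → w ≢ u → y' w ≡ y w) → y u < y' u →
    ∀ w → mate I y' w ≡ mate I y w)
    × (IsPassive I y u →
    ∀ (y' : Ranks n) → InUnit y' → (∀ w → w ≢ u → y' w ≡ y w) → y' u < y u →
    IsPassive I y' u)
lemma1 I y _ u =
    (λ not-passive y' _ → raise-preserves-matching I not-passive)
  , (λ u-passive y' _ → lower-preserves-passive I u-passive)
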